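{- Let $\ell\ge1$ and consider the root system of type $A_\ell$ with simple roots $\gamma_1,\dots,\gamma_\ell$ labelled along the Dynkin diagram (so that the positive roots are exactly $\sum_{i=n_1}^{n_2}\gamma_i$, $1\le n_1\le n_2\le\ell$). Let $S=\{i_1,\dots,i_m\}\subseteq\{1,\dots,\ell\}$ be nonempty with $i_1<\dots<i_m$, and put $i_0=0$, $i_{m+1}=\ell+1$. Let $\xi_1,\dots,\xi_\ell$ be the fundamental-weight coordinates of $\varphi_S$ (defined in the context). Then for every $j\in\{1,\dots,m\}$, $$\xi_{i_j}=2\Big(i_{j-1}-i_{j+1}+2\big(S_+(j)-S_-(j)\big)\Big),$$ where $$S_+(j)=\sum_{k=j+1}^{m}2(-1)^{k-j}i_k+i_{j+1}+(-1)^{m-j+1}(\ell+1),\qquad S_-(j)=\sum_{k=1}^{j-1}2(-1)^{k-j}i_k+i_{j-1}.$$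
   Context: $(\cdot,\cdot)$ is the positive definite inner product on the real span of the roots induced by the Killing form, and the Cartan matrix is $A_{ij}=\frac{2(\gamma_i,\gamma_j)}{(\gamma_i,\gamma_i)}$. $S$ is the set of indices of painted nodes of a Vogan diagram (non-compact simple roots). A positive root $\alpha=\sum_k n_k\gamma_k$ is compact if $\sum_{k\in S}n_k$ is even and non-compact otherwise; $\varepsilon_\alpha=-1$ for compact and $\varepsilon_\alpha=1$ for non-compact $\alpha$. Set $\eta=-2\sum_{\alpha\in\Delta_+}\varepsilon_\alpha\alpha$ and $\varphi_S=\eta-2\sum_{\alpha\in\mathrm{span}\{\gamma_k\,:\,k\notin S\}\cap\Delta_+}\alpha$. Writing $\varphi_S=\sum_k c_k\gamma_k$, define $\xi_i=\sum_k A_{ik}c_k=\frac{2(\varphi_S,\gamma_i)}{(\gamma_i,\gamma_i)}$ (the coefficients of $\varphi_S$ in the basis of fundamental dominant weights). -}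

module Defs where

open import Data.Nat as ℕ using (ℕ; zero; suc; _∸_; _≡ᵇ_; _≤ᵇ_)
open import Data.Integer using (ℤ; +_; -_; _+_; _*_; -1ℤ; 1ℤ; 0ℤ)
open import Data.Bool using (Bool; true; false; if_then_else_; _∧_)
open import Data.List using (List; []; _∷_; map; upTo; foldr)
open import Data.Bool.ListAction using (any)
open import Data.Vec using (Vec; toList)

range : ℕ → ℕ → List ℕ
range a b = map (a ℕ.+_) (upTo (suc b ∸ a))

sumℤ : List ℤ → ℤ
sumℤ = foldr _+_ 0ℤ

sumℕ : List ℕ → ℕ
sumℕ = foldr ℕ._+_ 0

Σ[_⋯_] : ℕ → ℕ → (ℕ → ℤ) → ℤ
Σ[ a ⋯ b ] f = sumℤ (map f (range a b))

[_] : Bool → ℤ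
[ true ] = 1ℤ
[ false ] = 0ℤ

sgn : ℕ → ℤ
sgn zero = 1ℤ
sgn (suc n) = - sgn n

cartanA : ℕ → ℕ → ℤ
cartanA i k =
  if i ≡ᵇ k then + 2
  else if (suc i ≡ᵇ k) Data.Bool.∨ (suc k ≡ᵇ i) then -1ℤ
  else 0ℤ

inS : List ℕ → ℕ → Bool
inS S k = any (_≡ᵇ k) S

-- positive root α = γ_{n1} + ... + γ_{n2}; its coefficient n_k on γ_k
rootCoeff : ℕ → ℕ → ℕ → ℤ
rootCoeff n1 n2 k = [ (n1 ≤ᵇ k) ∧ (k ≤ᵇ n2) ]

sCount : List ℕ → ℕ → ℕ → ℕ
sCount S n1 n2 = sumℕ (map (λ k → if inS S k then 1 else 0) (range n1 n2))

-- ε_α : -1 if α compact (Σ_{k∈S} n_k even), 1 if non-compact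
epsilon : List ℕ → ℕ → ℕ → ℤ
epsilon S n1 n2 = - sgn (sCount S n1 n2)

-- α ∈ span{γ_k : k ∉ S}
inComplSpan : List ℕ → ℕ → ℕ → Bool
inComplSpan S n1 n2 = sCount S n1 n2 ≡ᵇ 0

ΣposRoots : ℕ → (ℕ → ℕ → ℤ) → ℤ
ΣposRoots ℓ f = Σ[ 1 ⋯ ℓ ] (λ n1 → Σ[ n1 ⋯ ℓ ] (λ n2 → f n1 n2))

-- coefficient c_k of
-- φ_S = -2 Σ_{α>0} ε_α α - 2 Σ_{α>0, α ∈ span{γ_k : k∉S}} α
phiCoeff : ℕ → List ℕ → ℕ → ℤ
phiCoeff ℓ S k =
    ΣposRoots ℓ (λ n1 n2 → - (+ 2) * epsilon S n1 n2 * rootCoeff n1 n2 k)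
  + ΣposRoots ℓ (λ n1 n2 → - (+ 2) * [ inComplSpan S n1 n2 ] * rootCoeff n1 n2 k)

xi : ℕ → List ℕ → ℕ → ℤ
xi ℓ S i = Σ[ 1 ⋯ ℓ ] (λ k → cartanA i k * phiCoeff ℓ S k)

lookupOr : List ℕ → ℕ → ℕ → ℕ
lookupOr [] k d = d
lookupOr (x ∷ xs) zero d = x
lookupOr (x ∷ xs) (suc k) d = lookupOr xs k d

-- extended indices: I 0 = i_0 = 0, I j = i_j (1 ≤ j ≤ m), I (m+1) = ℓ+1
extIdx : ℕ → List ℕ → ℕ → ℕ
extIdx ℓ is zero = 0
extIdx ℓ is (suc k) = lookupOr is k (suc ℓ)

Splus : ℕ → ℕ → List ℕ → ℕ → ℤ
Splus ℓ m is j =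
    Σ[ suc j ⋯ m ] (λ k → + 2 * sgn (k ∸ j) * + extIdx ℓ is k)
  + + extIdx ℓ is (suc j)
  + sgn (suc (m ∸ j)) * + (suc ℓ)

-- S_-(j) = Σ_{k=1}^{j-1} 2(-1)^{k-j} i_k + i_{j-1}   ((-1)^{k-j} = (-1)^{j-k})
Sminus : ℕ → List ℕ → ℕ → ℤ
Sminus ℓ is j =
    Σ[ 1 ⋯ j ∸ 1 ] (λ k → + 2 * sgn (j ∸ k) * + extIdx ℓ is k)
  + + extIdx ℓ is (j ∸ 1)

-- Pairing φ_S with the coroot of γ_i, the i-th row of the Cartan matrix telescopes over a root
-- γ_a + ⋯ + γ_b, so ξ_i only sees the roots with an end at or next to i: it is a signed sum of the
-- coefficients of the roots starting at i or i+1 and of those ending at i-1 or i. The coefficient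
-- of a root in φ_S depends only on the number c of painted nodes it contains; it is 0 for c = 0
-- and 2(-1)^c otherwise. For painted i this leaves -4 plus, on each side of i, twice the number of
-- roots issuing from i±1 that avoid S and -4 times the alternating sum of (-1)^c over them. Moving
-- away from i, c grows by one exactly at the painted nodes, so these quantities satisfy two-term
-- recurrences across the gaps between consecutive painted nodes; S_+(j) and S_-(j) satisfy the
-- same recurrences with the same initial values.

module Submission where

open import Defs
open import Data.Bool using (true; false; if_then_else_; _∨_)
import Data.Bool.Properties as Boolₚ
open import Data.Empty using (⊥-elim)
open import Data.Sum using (inj₁; inj₂)
open import Data.Integer using (ℤ; +_; -_; _+_; _-_; _*_; _⊖_; -1ℤ; 1ℤ; 0ℤ)
import Data.Integer.Properties as ℤₚ
open import Data.Integer.Tactic.RingSolver using (solve-∀)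
open import Data.List using (List; []; _∷_; _++_; map; applyUpTo; upTo; length)
import Data.List.Properties as Listₚ
open import Data.List.Relation.Unary.All as All using (All)
import Data.List.Relation.Unary.All.Properties as Allₚ
open import Data.Fin using (Fin; zero; suc; toℕ; fromℕ<)
import Data.Fin.Properties as Finₚ
open import Data.Nat as ℕ using (ℕ; zero; suc; pred; _∸_; _≡ᵇ_; _≤ᵇ_; _≤_; _<_; z≤n; s≤s)
import Data.Nat.ListAction.Properties as ℕListₚ
import Data.Nat.Properties as ℕₚ
open import Data.Product using (_×_; _,_; proj₁; proj₂; ∃)
open import Data.Vec using (Vec; []; _∷_; lookup; toList)
open import Function using (_∘_; Equivalence)
open import Relation.Binary.PropositionalEquality hiding ([_])
open import Relation.Nullary using (Dec; yes; no)

≡ᵇ-refl : ∀ n → (n ≡ᵇ n) ≡ true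
≡ᵇ-refl zero    = refl
≡ᵇ-refl (suc n) = ≡ᵇ-refl n

≢⇒≡ᵇ≡false : ∀ m n → m ≢ n → (m ≡ᵇ n) ≡ false
≢⇒≡ᵇ≡false zero    zero    m≢n = ⊥-elim (m≢n refl)
≢⇒≡ᵇ≡false zero    (suc n) _   = refl
≢⇒≡ᵇ≡false (suc m) zero    _   = refl
≢⇒≡ᵇ≡false (suc m) (suc n) m≢n = ≢⇒≡ᵇ≡false m n (m≢n ∘ cong suc)

≤⇒≤ᵇ≡true : ∀ {m n} → m ≤ n → (m ≤ᵇ n) ≡ true
≤⇒≤ᵇ≡true m≤n = Equivalence.to Boolₚ.T-≡ (ℕₚ.≤⇒≤ᵇ m≤n)

>⇒≤ᵇ≡false : ∀ {m n} → n < m → (m ≤ᵇ n) ≡ false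
>⇒≤ᵇ≡false {m} {n} n<m = Boolₚ.¬-not (ℕₚ.<⇒≱ n<m ∘ ℕₚ.≤ᵇ⇒≤ m n ∘ Equivalence.from Boolₚ.T-≡)

[≡ᵇ]-refl : ∀ n → [ n ≡ᵇ n ] ≡ 1ℤ
[≡ᵇ]-refl n = cong [_] (≡ᵇ-refl n)

[≡ᵇ]-≢ : ∀ m n → m ≢ n → [ m ≡ᵇ n ] ≡ 0ℤ
[≡ᵇ]-≢ m n m≢n = cong [_] (≢⇒≡ᵇ≡false m n m≢n)

isolate : ∀ {x y z : ℤ} → x + y ≡ z → x ≡ z - y
isolate {x} {y} refl = sym (undo x y)
  where
  undo : ∀ x y → x + y - y ≡ x
  undo = solve-∀

-- Sums over integer intervals

applyUpTo-++ : ∀ {A : Set} (f : ℕ → A) n p → applyUpTo f (n ℕ.+ p) ≡ applyUpTo f n ++ applyUpTo (f ∘ (n ℕ.+_)) p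
applyUpTo-++ f zero    p = refl
applyUpTo-++ f (suc n) p = cong (f 0 ∷_) (applyUpTo-++ (f ∘ suc) n p)

range-applyUpTo : ∀ a b → range a b ≡ applyUpTo (a ℕ.+_) (suc b ∸ a)
range-applyUpTo a b = Listₚ.map-upTo (a ℕ.+_) (suc b ∸ a)

range-length : ∀ a b → length (range a b) ≡ suc b ∸ a
range-length a b = trans (cong length (range-applyUpTo a b)) (Listₚ.length-applyUpTo (a ℕ.+_) (suc b ∸ a))

range-empty : ∀ a b → b < a → range a b ≡ []
range-empty a b b<a = cong (map (a ℕ.+_) ∘ upTo) (ℕₚ.m≤n⇒m∸n≡0 b<a)

range-single : ∀ a → range a a ≡ a ∷ []
range-single a rewrite ℕₚ.m+n∸n≡m 1 a = cong (_∷ []) (ℕₚ.+-identityʳ a)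

range-all : ∀ {P : ℕ → Set} a b → (∀ k → a ≤ k → k ≤ b → P k) → All P (range a b)
range-all a b p = subst (All _) (sym (range-applyUpTo a b)) (Allₚ.applyUpTo⁺₁ (a ℕ.+_) (suc b ∸ a) λ {t} t<n →
  p (a ℕ.+ t) (ℕₚ.m≤m+n a t) (ℕₚ.≤-pred (lt a (suc b) t t<n)))
  where
  lt : ∀ a b t → t < b ∸ a → a ℕ.+ t < b
  lt zero    b       t t<b   = t<b
  lt (suc a) (suc b) t t<b∸a = s≤s (lt a b t t<b∸a)

range-++ : ∀ a b c → a ≤ suc c → c ≤ b → range a b ≡ range a c ++ range (suc c) b
range-++ a b c a≤1+c c≤b = begin
  range a b                                                      ≡⟨ range-applyUpTo a b ⟩
  applyUpTo (a ℕ.+_) (suc b ∸ a)                                 ≡⟨ cong (applyUpTo (a ℕ.+_)) length-split ⟩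
  applyUpTo (a ℕ.+_) (n ℕ.+ (b ∸ c))                             ≡⟨ applyUpTo-++ (a ℕ.+_) n (b ∸ c) ⟩
  applyUpTo (a ℕ.+_) n ++ applyUpTo (λ t → a ℕ.+ (n ℕ.+ t)) (b ∸ c) ≡⟨ cong₂ _++_ (sym (range-applyUpTo a c)) shifted ⟩
  range a c ++ range (suc c) b                                   ∎
  where
  open ≡-Reasoning
  n : ℕ
  n = suc c ∸ a
  length-split : suc b ∸ a ≡ n ℕ.+ (b ∸ c)
  length-split = trans (cong (λ x → suc x ∸ a) (sym (ℕₚ.m+[n∸m]≡n c≤b))) (ℕₚ.+-∸-comm (b ∸ c) a≤1+c)
  shifted : applyUpTo (λ t → a ℕ.+ (n ℕ.+ t)) (b ∸ c) ≡ range (suc c) b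
  shifted = trans (sym (Listₚ.map-upTo _ (b ∸ c)))
    (Listₚ.map-cong (λ t → trans (sym (ℕₚ.+-assoc a n t)) (cong (ℕ._+ t) (ℕₚ.m+[n∸m]≡n a≤1+c))) (upTo (b ∸ c)))

sumℤ-++ : ∀ xs ys → sumℤ (xs ++ ys) ≡ sumℤ xs + sumℤ ys
sumℤ-++ []       ys = sym (ℤₚ.+-identityˡ (sumℤ ys))
sumℤ-++ (x ∷ xs) ys = trans (cong (_+_ x) (sumℤ-++ xs ys)) (sym (ℤₚ.+-assoc x (sumℤ xs) (sumℤ ys)))

sumℤ-map-+ : ∀ {A : Set} (f g : A → ℤ) xs → sumℤ (map (λ x → f x + g x) xs) ≡ sumℤ (map f xs) + sumℤ (map g xs)
sumℤ-map-+ f g []       = refl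
sumℤ-map-+ f g (x ∷ xs) = trans (cong (_+_ (f x + g x)) (sumℤ-map-+ f g xs)) (interchange (f x) (g x) _ _)
  where
  interchange : ∀ a b c d → a + b + (c + d) ≡ a + c + (b + d)
  interchange = solve-∀

sumℤ-map-*ˡ : ∀ {A : Set} c (f : A → ℤ) xs → sumℤ (map (λ x → c * f x) xs) ≡ c * sumℤ (map f xs)
sumℤ-map-*ˡ c f []       = sym (ℤₚ.*-zeroʳ c)
sumℤ-map-*ˡ c f (x ∷ xs) = trans (cong (_+_ (c * f x)) (sumℤ-map-*ˡ c f xs)) (sym (ℤₚ.*-distribˡ-+ c (f x) _))

sumℤ-map-const : ∀ {A : Set} c (xs : List A) → sumℤ (map (λ _ → c) xs) ≡ + length xs * c
sumℤ-map-const c []       = refl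
sumℤ-map-const c (x ∷ xs) = trans (cong (_+_ c) (sumℤ-map-const c xs)) (sym (ℤₚ.suc-* (+ length xs) c))

sumℤ-map-zero : ∀ {A : Set} {f : A → ℤ} {xs} → All (λ x → f x ≡ 0ℤ) xs → sumℤ (map f xs) ≡ 0ℤ
sumℤ-map-zero All.[]           = refl
sumℤ-map-zero (fx≡0 All.∷ fxs≡0) = cong₂ _+_ fx≡0 (sumℤ-map-zero fxs≡0)

sumℤ-map-comm : ∀ {A B : Set} (h : A → B → ℤ) xs ys →
  sumℤ (map (λ x → sumℤ (map (h x) ys)) xs) ≡ sumℤ (map (λ y → sumℤ (map (λ x → h x y) xs)) ys)
sumℤ-map-comm h []       ys = sym (sumℤ-map-zero (All.universal (λ _ → refl) ys))
sumℤ-map-comm h (x ∷ xs) ys =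
  trans (cong (_+_ (sumℤ (map (h x) ys))) (sumℤ-map-comm h xs ys)) (sym (sumℤ-map-+ (h x) _ ys))

sumℕ-map-zero : ∀ {A : Set} {f : A → ℕ} {xs} → All (λ x → f x ≡ 0) xs → sumℕ (map f xs) ≡ 0
sumℕ-map-zero All.[]           = refl
sumℕ-map-zero (fx≡0 All.∷ fxs≡0) = cong₂ ℕ._+_ fx≡0 (sumℕ-map-zero fxs≡0)

Σ-cong : ∀ a b {f g : ℕ → ℤ} → (∀ k → a ≤ k → k ≤ b → f k ≡ g k) → Σ[ a ⋯ b ] f ≡ Σ[ a ⋯ b ] g
Σ-cong a b f≡g = cong sumℤ (Listₚ.map-cong-local (range-all a b f≡g))

Σ-+ : ∀ a b (f g : ℕ → ℤ) → Σ[ a ⋯ b ] (λ k → f k + g k) ≡ Σ[ a ⋯ b ] f + Σ[ a ⋯ b ] g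
Σ-+ a b f g = sumℤ-map-+ f g (range a b)

Σ-*ˡ : ∀ a b c (f : ℕ → ℤ) → Σ[ a ⋯ b ] (λ k → c * f k) ≡ c * Σ[ a ⋯ b ] f
Σ-*ˡ a b c f = sumℤ-map-*ˡ c f (range a b)

Σ-*ʳ : ∀ a b (f : ℕ → ℤ) c → Σ[ a ⋯ b ] (λ k → f k * c) ≡ Σ[ a ⋯ b ] f * c
Σ-*ʳ a b f c = trans (Σ-cong a b (λ k _ _ → ℤₚ.*-comm (f k) c)) (trans (Σ-*ˡ a b c f) (ℤₚ.*-comm c _))

Σ-neg : ∀ a b (f : ℕ → ℤ) → Σ[ a ⋯ b ] (λ k → - f k) ≡ - Σ[ a ⋯ b ] f
Σ-neg a b f = trans (Σ-cong a b (λ k _ _ → sym (ℤₚ.-1*i≡-i (f k)))) (trans (Σ-*ˡ a b -1ℤ f) (ℤₚ.-1*i≡-i _))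

Σ-sub : ∀ a b (f g : ℕ → ℤ) → Σ[ a ⋯ b ] (λ k → f k - g k) ≡ Σ[ a ⋯ b ] f - Σ[ a ⋯ b ] g
Σ-sub a b f g = trans (Σ-+ a b f (λ k → - g k)) (cong (_+_ (Σ[ a ⋯ b ] f)) (Σ-neg a b g))

Σ-lincomb : ∀ a b x y (f g : ℕ → ℤ) →
            Σ[ a ⋯ b ] (λ k → x * f k + y * g k) ≡ x * Σ[ a ⋯ b ] f + y * Σ[ a ⋯ b ] g
Σ-lincomb a b x y f g = trans (Σ-+ a b _ _) (cong₂ _+_ (Σ-*ˡ a b x f) (Σ-*ˡ a b y g))

Σ-const : ∀ a b c → Σ[ a ⋯ b ] (λ _ → c) ≡ + (suc b ∸ a) * c
Σ-const a b c = trans (sumℤ-map-const c (range a b)) (cong (λ n → + n * c) (range-length a b))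

Σ-zero : ∀ a b {f : ℕ → ℤ} → (∀ k → a ≤ k → k ≤ b → f k ≡ 0ℤ) → Σ[ a ⋯ b ] f ≡ 0ℤ
Σ-zero a b f≡0 = sumℤ-map-zero (range-all a b f≡0)

Σ-empty : ∀ a b (f : ℕ → ℤ) → b < a → Σ[ a ⋯ b ] f ≡ 0ℤ
Σ-empty a b f b<a = cong (sumℤ ∘ map f) (range-empty a b b<a)

Σ-single : ∀ a (f : ℕ → ℤ) → Σ[ a ⋯ a ] f ≡ f a
Σ-single a f = trans (cong (sumℤ ∘ map f) (range-single a)) (ℤₚ.+-identityʳ (f a))

Σ-split : ∀ a b c (f : ℕ → ℤ) → a ≤ suc c → c ≤ b → Σ[ a ⋯ b ] f ≡ Σ[ a ⋯ c ] f + Σ[ suc c ⋯ b ] f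
Σ-split a b c f a≤1+c c≤b = trans (cong (sumℤ ∘ map f) (range-++ a b c a≤1+c c≤b))
  (trans (cong sumℤ (Listₚ.map-++ f (range a c) _)) (sumℤ-++ (map f (range a c)) _))

Σ-comm : ∀ a b c d (h : ℕ → ℕ → ℤ) →
  Σ[ a ⋯ b ] (λ k → Σ[ c ⋯ d ] (h k)) ≡ Σ[ c ⋯ d ] (λ j → Σ[ a ⋯ b ] (λ k → h k j))
Σ-comm a b c d h = sumℤ-map-comm h (range a b) (range c d)

sumℤ-applyUpTo-telescope : ∀ (q : ℕ → ℤ) n → sumℤ (applyUpTo (λ t → q t - q (suc t)) n) ≡ q 0 - q n
sumℤ-applyUpTo-telescope q zero    = sym (ℤₚ.+-inverseʳ (q 0))
sumℤ-applyUpTo-telescope q (suc n) =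
  trans (cong (_+_ (q 0 - q 1)) (sumℤ-applyUpTo-telescope (q ∘ suc) n)) (cancel (q 0) (q 1) (q (suc n)))
  where
  cancel : ∀ x y z → x - y + (y - z) ≡ x - z
  cancel = solve-∀

Σ-telescope : ∀ a b (q : ℕ → ℤ) → a ≤ suc b → Σ[ a ⋯ b ] (λ k → q k - q (suc k)) ≡ q a - q (suc b)
Σ-telescope a b q a≤1+b = begin
  Σ[ a ⋯ b ] (λ k → q k - q (suc k))                  ≡⟨ cong sumℤ (Listₚ.map-∘ (upTo n)) ⟨
  sumℤ (map (λ t → q (a ℕ.+ t) - q (suc (a ℕ.+ t))) (upTo n)) ≡⟨ cong sumℤ (Listₚ.map-cong shift (upTo n)) ⟩
  sumℤ (map (λ t → q′ t - q′ (suc t)) (upTo n))        ≡⟨ cong sumℤ (Listₚ.map-upTo _ n) ⟩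
  sumℤ (applyUpTo (λ t → q′ t - q′ (suc t)) n)         ≡⟨ sumℤ-applyUpTo-telescope q′ n ⟩
  q (a ℕ.+ 0) - q (a ℕ.+ n)                           ≡⟨ cong₂ (λ x y → q x - q y) (ℕₚ.+-identityʳ a) (ℕₚ.m+[n∸m]≡n a≤1+b) ⟩
  q a - q (suc b)                                     ∎
  where
  open ≡-Reasoning
  n : ℕ
  n = suc b ∸ a
  q′ : ℕ → ℤ
  q′ t = q (a ℕ.+ t)
  shift : ∀ t → q (a ℕ.+ t) - q (suc (a ℕ.+ t)) ≡ q′ t - q′ (suc t)
  shift t = cong (λ x → q (a ℕ.+ t) - q x) (sym (ℕₚ.+-suc a t))

Σ-delta : ∀ a b j (f : ℕ → ℤ) → a ≤ j → j ≤ b →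
          (∀ k → a ≤ k → k ≤ b → k ≢ j → f k ≡ 0ℤ) → Σ[ a ⋯ b ] f ≡ f j
Σ-delta a b j f a≤j j≤b f≡0 = begin
  Σ[ a ⋯ b ] f                      ≡⟨ Σ-split a b j f (ℕₚ.m≤n⇒m≤1+n a≤j) j≤b ⟩
  Σ[ a ⋯ j ] f + Σ[ suc j ⋯ b ] f   ≡⟨ cong₂ _+_ (up-to j a≤j below) (Σ-zero (suc j) b above) ⟩
  f j + 0ℤ                          ≡⟨ ℤₚ.+-identityʳ (f j) ⟩
  f j                               ∎
  where
  open ≡-Reasoning
  below : ∀ k → a ≤ k → k < j → f k ≡ 0ℤ
  below k a≤k k<j = f≡0 k a≤k (ℕₚ.≤-trans (ℕₚ.<⇒≤ k<j) j≤b) (ℕₚ.<⇒≢ k<j)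
  above : ∀ k → suc j ≤ k → k ≤ b → f k ≡ 0ℤ
  above k j<k k≤b = f≡0 k (ℕₚ.≤-trans a≤j (ℕₚ.<⇒≤ j<k)) k≤b (ℕₚ.>⇒≢ j<k)
  up-to : ∀ j → a ≤ j → (∀ k → a ≤ k → k < j → f k ≡ 0ℤ) → Σ[ a ⋯ j ] f ≡ f j
  up-to zero    z≤n _      = Σ-single 0 f
  up-to (suc c) a≤j f≡0′ = begin
    Σ[ a ⋯ suc c ] f                    ≡⟨ Σ-split a (suc c) c f a≤j (ℕₚ.n≤1+n c) ⟩
    Σ[ a ⋯ c ] f + Σ[ suc c ⋯ suc c ] f ≡⟨ cong₂ _+_ (Σ-zero a c (λ k a≤k k≤c → f≡0′ k a≤k (s≤s k≤c)))
                                                     (Σ-single (suc c) f) ⟩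
    0ℤ + f (suc c)                      ≡⟨ ℤₚ.+-identityˡ _ ⟩
    f (suc c)                           ∎

Σ-indicator : ∀ a b j (f : ℕ → ℤ) → a ≤ j → j ≤ b → Σ[ a ⋯ b ] (λ k → f k * [ k ≡ᵇ j ]) ≡ f j
Σ-indicator a b j f a≤j j≤b =
  trans (Σ-delta a b j _ a≤j j≤b (λ k _ _ k≢j → trans (cong (f k *_) ([≡ᵇ]-≢ k j k≢j)) (ℤₚ.*-zeroʳ (f k))))
        (trans (cong (f j *_) ([≡ᵇ]-refl j)) (ℤₚ.*-identityʳ (f j)))

Σ-indicator-outside : ∀ a b j (f : ℕ → ℤ) → (∀ k → a ≤ k → k ≤ b → k ≢ j) →
                      Σ[ a ⋯ b ] (λ k → f k * [ k ≡ᵇ j ]) ≡ 0ℤ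
Σ-indicator-outside a b j f k≢j =
  Σ-zero a b (λ k a≤k k≤b → trans (cong (f k *_) ([≡ᵇ]-≢ k j (k≢j k a≤k k≤b))) (ℤₚ.*-zeroʳ (f k)))

-- Counting painted nodes

module _ (S : List ℕ) where

  private
    painted : ℕ → ℕ
    painted k = if inS S k then 1 else 0

  sCount-split : ∀ a b c → a ≤ suc c → c ≤ b → sCount S a b ≡ sCount S a c ℕ.+ sCount S (suc c) b
  sCount-split a b c a≤1+c c≤b = trans (cong (sumℕ ∘ map painted) (range-++ a b c a≤1+c c≤b))
    (trans (cong sumℕ (Listₚ.map-++ painted (range a c) _)) (ℕListₚ.sum-++ (map painted (range a c)) _))

  sCount-painted : ∀ a → inS S a ≡ true → sCount S a a ≡ 1
  sCount-painted a a∈S = trans (cong (sumℕ ∘ map painted) (range-single a)) (cong (λ x → (if x then 1 else 0) ℕ.+ 0) a∈S)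

  sCount-unpainted : ∀ a b → (∀ k → a ≤ k → k ≤ b → inS S k ≡ false) → sCount S a b ≡ 0
  sCount-unpainted a b k∉S =
    sumℕ-map-zero (range-all a b (λ k a≤k k≤b → cong (λ x → if x then 1 else 0) (k∉S k a≤k k≤b)))

  sCount-paintedˡ : ∀ a b → inS S a ≡ true → a ≤ b → sCount S a b ≡ suc (sCount S (suc a) b)
  sCount-paintedˡ a b a∈S a≤b =
    trans (sCount-split a b a (ℕₚ.n≤1+n a) a≤b) (cong (ℕ._+ sCount S (suc a) b) (sCount-painted a a∈S))

  sCount-paintedʳ : ∀ a b → inS S (suc b) ≡ true → a ≤ suc b → sCount S a (suc b) ≡ suc (sCount S a b)
  sCount-paintedʳ a b 1+b∈S a≤1+b = trans (sCount-split a (suc b) b a≤1+b (ℕₚ.n≤1+n b))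
    (trans (cong (sCount S a b ℕ.+_) (sCount-painted (suc b) 1+b∈S)) (ℕₚ.+-comm (sCount S a b) 1))

-- Positive roots of A_ℓ, the Cartan matrix and φ_S

rootCoeff-inside : ∀ a b k → a ≤ k → k ≤ b → rootCoeff a b k ≡ 1ℤ
rootCoeff-inside a b k a≤k k≤b rewrite ≤⇒≤ᵇ≡true a≤k | ≤⇒≤ᵇ≡true k≤b = refl

rootCoeff-below : ∀ a b k → k < a → rootCoeff a b k ≡ 0ℤ
rootCoeff-below a b k k<a rewrite >⇒≤ᵇ≡false k<a = refl

rootCoeff-above : ∀ a b k → a ≤ k → b < k → rootCoeff a b k ≡ 0ℤ
rootCoeff-above a b k a≤k b<k rewrite ≤⇒≤ᵇ≡true a≤k | >⇒≤ᵇ≡false b<k = refl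

edge : ℕ → ℕ → ℤ
edge i x = [ x ≡ᵇ i ] - [ x ≡ᵇ suc i ]

cartanA-edge : ∀ i k → cartanA i k ≡ edge i k - edge i (suc k)
cartanA-edge zero          zero          = refl
cartanA-edge zero          (suc zero)    = refl
cartanA-edge zero          (suc (suc k)) = refl
cartanA-edge (suc zero)    zero          = refl
cartanA-edge (suc (suc i)) zero          = refl
cartanA-edge (suc i)       (suc k)       = cartanA-edge i k

cartanA-rootCoeff : ∀ ℓ i a b → 1 ≤ a → a ≤ b → b ≤ ℓ →
  Σ[ 1 ⋯ ℓ ] (λ k → cartanA i k * rootCoeff a b k) ≡ edge i a - edge i (suc b)
cartanA-rootCoeff ℓ i a@(suc a′) b 1≤a a≤b b≤ℓ = begin
  Σ[ 1 ⋯ ℓ ] f                                     ≡⟨ Σ-split 1 ℓ a′ f 1≤a (ℕₚ.≤-trans (ℕₚ.n≤1+n a′) (ℕₚ.≤-trans a≤b b≤ℓ)) ⟩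
  Σ[ 1 ⋯ a′ ] f + Σ[ a ⋯ ℓ ] f                      ≡⟨ cong₂ _+_ below (Σ-split a ℓ b f (ℕₚ.m≤n⇒m≤1+n a≤b) b≤ℓ) ⟩
  0ℤ + (Σ[ a ⋯ b ] f + Σ[ suc b ⋯ ℓ ] f)            ≡⟨ cong (λ x → 0ℤ + (Σ[ a ⋯ b ] f + x)) above ⟩
  0ℤ + (Σ[ a ⋯ b ] f + 0ℤ)                          ≡⟨ trans (ℤₚ.+-identityˡ _) (ℤₚ.+-identityʳ _) ⟩
  Σ[ a ⋯ b ] f                                     ≡⟨ Σ-cong a b inside ⟩
  Σ[ a ⋯ b ] (λ k → edge i k - edge i (suc k))      ≡⟨ Σ-telescope a b (edge i) (ℕₚ.m≤n⇒m≤1+n a≤b) ⟩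
  edge i a - edge i (suc b)                        ∎
  where
  open ≡-Reasoning
  f : ℕ → ℤ
  f k = cartanA i k * rootCoeff a b k
  below : Σ[ 1 ⋯ a′ ] f ≡ 0ℤ
  below = Σ-zero 1 a′ (λ k _ k≤a′ →
    trans (cong (cartanA i k *_) (rootCoeff-below a b k (s≤s k≤a′))) (ℤₚ.*-zeroʳ (cartanA i k)))
  above : Σ[ suc b ⋯ ℓ ] f ≡ 0ℤ
  above = Σ-zero (suc b) ℓ (λ k b<k _ →
    trans (cong (cartanA i k *_) (rootCoeff-above a b k (ℕₚ.≤-trans a≤b (ℕₚ.<⇒≤ b<k)) b<k)) (ℤₚ.*-zeroʳ (cartanA i k)))
  inside : ∀ k → a ≤ k → k ≤ b → f k ≡ edge i k - edge i (suc k)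
  inside k a≤k k≤b = trans (cong (cartanA i k *_) (rootCoeff-inside a b k a≤k k≤b))
                           (trans (ℤₚ.*-identityʳ _) (cartanA-edge i k))

module _ (ℓ : ℕ) where

  ΣposRoots-cong : ∀ {F G : ℕ → ℕ → ℤ} → (∀ a b → 1 ≤ a → a ≤ b → b ≤ ℓ → F a b ≡ G a b) →
                   ΣposRoots ℓ F ≡ ΣposRoots ℓ G
  ΣposRoots-cong F≡G = Σ-cong 1 ℓ (λ a 1≤a _ → Σ-cong a ℓ (λ b a≤b b≤ℓ → F≡G a b 1≤a a≤b b≤ℓ))

  ΣposRoots-+ : ∀ (F G : ℕ → ℕ → ℤ) → ΣposRoots ℓ (λ a b → F a b + G a b) ≡ ΣposRoots ℓ F + ΣposRoots ℓ G
  ΣposRoots-+ F G = trans (Σ-cong 1 ℓ (λ a _ _ → Σ-+ a ℓ (F a) (G a))) (Σ-+ 1 ℓ _ _)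

  ΣposRoots-*ˡ : ∀ c (F : ℕ → ℕ → ℤ) → ΣposRoots ℓ (λ a b → c * F a b) ≡ c * ΣposRoots ℓ F
  ΣposRoots-*ˡ c F = trans (Σ-cong 1 ℓ (λ a _ _ → Σ-*ˡ a ℓ c (F a))) (Σ-*ˡ 1 ℓ c _)

  ΣposRoots-first : ∀ (F : ℕ → ℕ → ℤ) j → 1 ≤ j →
                    ΣposRoots ℓ (λ a b → F a b * [ a ≡ᵇ j ]) ≡ Σ[ j ⋯ ℓ ] (F j)
  ΣposRoots-first F j 1≤j = trans (Σ-cong 1 ℓ (λ a _ _ → Σ-*ʳ a ℓ (F a) [ a ≡ᵇ j ])) (by-cases (j ℕ.≤? ℓ))
    where
    by-cases : Dec (j ≤ ℓ) → Σ[ 1 ⋯ ℓ ] (λ a → Σ[ a ⋯ ℓ ] (F a) * [ a ≡ᵇ j ]) ≡ Σ[ j ⋯ ℓ ] (F j)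
    by-cases (yes j≤ℓ) = Σ-indicator 1 ℓ j (λ a → Σ[ a ⋯ ℓ ] (F a)) 1≤j j≤ℓ
    by-cases (no  j≰ℓ) =
      trans (Σ-indicator-outside 1 ℓ j (λ a → Σ[ a ⋯ ℓ ] (F a)) (λ a _ a≤ℓ a≡j → j≰ℓ (subst (_≤ ℓ) a≡j a≤ℓ)))
            (sym (Σ-empty j ℓ (F j) (ℕₚ.≰⇒> j≰ℓ)))

  ΣposRoots-last : ∀ (F : ℕ → ℕ → ℤ) j → j ≤ ℓ →
                   ΣposRoots ℓ (λ a b → F a b * [ b ≡ᵇ j ]) ≡ Σ[ 1 ⋯ j ] (λ a → F a j)
  ΣposRoots-last F j j≤ℓ = begin
    ΣposRoots ℓ (λ a b → F a b * [ b ≡ᵇ j ])   ≡⟨ Σ-split 1 ℓ j _ (s≤s z≤n) j≤ℓ ⟩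
    Σ[ 1 ⋯ j ] inner + Σ[ suc j ⋯ ℓ ] inner    ≡⟨ cong₂ _+_ (Σ-cong 1 j (λ a _ a≤j → Σ-indicator a ℓ j (F a) a≤j j≤ℓ))
                                                             (Σ-zero (suc j) ℓ (λ a j<a _ → Σ-indicator-outside a ℓ j (F a)
                                                               (λ b a≤b _ → ℕₚ.>⇒≢ (ℕₚ.<-≤-trans j<a a≤b)))) ⟩
    Σ[ 1 ⋯ j ] (λ a → F a j) + 0ℤ              ≡⟨ ℤₚ.+-identityʳ _ ⟩
    Σ[ 1 ⋯ j ] (λ a → F a j)                   ∎
    where
    open ≡-Reasoning
    inner : ℕ → ℤ
    inner a = Σ[ a ⋯ ℓ ] (λ b → F a b * [ b ≡ᵇ j ])

  cartanA-ΣposRoots : ∀ i (F : ℕ → ℕ → ℤ) →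
    Σ[ 1 ⋯ ℓ ] (λ k → cartanA i k * ΣposRoots ℓ (λ a b → F a b * rootCoeff a b k))
      ≡ ΣposRoots ℓ (λ a b → F a b * (edge i a - edge i (suc b)))
  cartanA-ΣposRoots i F = begin
    Σ[ 1 ⋯ ℓ ] (λ k → cartanA i k * ΣposRoots ℓ (λ a b → F a b * rootCoeff a b k))
      ≡⟨ Σ-cong 1 ℓ (λ k _ _ → sym (ΣposRoots-*ˡ (cartanA i k) _)) ⟩
    Σ[ 1 ⋯ ℓ ] (λ k → Σ[ 1 ⋯ ℓ ] (λ a → Σ[ a ⋯ ℓ ] (λ b → cartanA i k * (F a b * rootCoeff a b k))))
      ≡⟨ Σ-comm 1 ℓ 1 ℓ _ ⟩
    Σ[ 1 ⋯ ℓ ] (λ a → Σ[ 1 ⋯ ℓ ] (λ k → Σ[ a ⋯ ℓ ] (λ b → cartanA i k * (F a b * rootCoeff a b k))))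
      ≡⟨ Σ-cong 1 ℓ (λ a _ _ → Σ-comm 1 ℓ a ℓ _) ⟩
    ΣposRoots ℓ (λ a b → Σ[ 1 ⋯ ℓ ] (λ k → cartanA i k * (F a b * rootCoeff a b k)))
      ≡⟨ ΣposRoots-cong (λ a b 1≤a a≤b b≤ℓ → trans (Σ-cong 1 ℓ (λ k _ _ → swap (cartanA i k) (F a b) (rootCoeff a b k)))
           (trans (Σ-*ˡ 1 ℓ (F a b) _) (cong (F a b *_) (cartanA-rootCoeff ℓ i a b 1≤a a≤b b≤ℓ)))) ⟩
    ΣposRoots ℓ (λ a b → F a b * (edge i a - edge i (suc b)))
      ∎
    where
    open ≡-Reasoning
    swap : ∀ x y z → x * (y * z) ≡ y * (x * z)
    swap = solve-∀

  ΣposRoots-edge : ∀ (F : ℕ → ℕ → ℤ) i → suc i ≤ ℓ →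
    ΣposRoots ℓ (λ a b → F a b * (edge (suc i) a - edge (suc i) (suc b)))
      ≡ Σ[ suc i ⋯ ℓ ] (F (suc i)) - Σ[ suc (suc i) ⋯ ℓ ] (F (suc (suc i)))
        - Σ[ 1 ⋯ i ] (λ a → F a i) + Σ[ 1 ⋯ suc i ] (λ a → F a (suc i))
  ΣposRoots-edge F i 1+i≤ℓ = begin
    ΣposRoots ℓ (λ a b → F a b * (edge (suc i) a - edge (suc i) (suc b)))
      ≡⟨ ΣposRoots-cong (λ a b _ _ _ → expand (F a b) [ a ≡ᵇ suc i ] [ a ≡ᵇ suc (suc i) ] [ b ≡ᵇ i ] [ b ≡ᵇ suc i ]) ⟩
    ΣposRoots ℓ (λ a b → (first (suc i) a b + -1ℤ * first (suc (suc i)) a b) + (-1ℤ * last i a b + last (suc i) a b))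
      ≡⟨ ΣposRoots-+ _ _ ⟩
    ΣposRoots ℓ (λ a b → first (suc i) a b + -1ℤ * first (suc (suc i)) a b)
      + ΣposRoots ℓ (λ a b → -1ℤ * last i a b + last (suc i) a b)
      ≡⟨ cong₂ _+_ (trans (ΣposRoots-+ _ _) (cong (_+_ (ΣposRoots ℓ (first (suc i)))) (ΣposRoots-*ˡ -1ℤ _)))
                   (trans (ΣposRoots-+ _ _) (cong (_+ ΣposRoots ℓ (last (suc i))) (ΣposRoots-*ˡ -1ℤ _))) ⟩
    (ΣposRoots ℓ (first (suc i)) + -1ℤ * ΣposRoots ℓ (first (suc (suc i))))
      + (-1ℤ * ΣposRoots ℓ (last i) + ΣposRoots ℓ (last (suc i)))
      ≡⟨ cong₂ _+_ (cong₂ (λ x y → x + -1ℤ * y) (ΣposRoots-first F (suc i) (s≤s z≤n))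
                                                 (ΣposRoots-first F (suc (suc i)) (s≤s z≤n)))
                   (cong₂ (λ x y → -1ℤ * x + y) (ΣposRoots-last F i (ℕₚ.≤-trans (ℕₚ.n≤1+n i) 1+i≤ℓ))
                                                 (ΣposRoots-last F (suc i) 1+i≤ℓ)) ⟩
    (startsAt (suc i) + -1ℤ * startsAt (suc (suc i))) + (-1ℤ * endsAt i + endsAt (suc i))
      ≡⟨ regroup (startsAt (suc i)) (startsAt (suc (suc i))) (endsAt i) (endsAt (suc i)) ⟩
    startsAt (suc i) - startsAt (suc (suc i)) - endsAt i + endsAt (suc i)
      ∎
    where
    open ≡-Reasoning
    first last : ℕ → ℕ → ℕ → ℤ
    first j a b = F a b * [ a ≡ᵇ j ]
    last  j a b = F a b * [ b ≡ᵇ j ]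
    startsAt endsAt : ℕ → ℤ
    startsAt j = Σ[ j ⋯ ℓ ] (F j)
    endsAt   j = Σ[ 1 ⋯ j ] (λ a → F a j)
    expand : ∀ w x y z u → w * ((x - y) - (z - u)) ≡ (w * x + -1ℤ * (w * y)) + (-1ℤ * (w * z) + w * u)
    expand = solve-∀
    regroup : ∀ x y z u → (x + -1ℤ * y) + (-1ℤ * z + u) ≡ x - y - z + u
    regroup = solve-∀

-- The coefficient -2ε_α - 2[α ∈ span{γ_k : k ∉ S}] of a positive root α with c painted nodes.
weight : ℕ → ℤ
weight zero    = 0ℤ
weight (suc c) = - (+ 2) * sgn c

isZero : ℕ → ℤ
isZero c = [ c ≡ᵇ 0 ]

weight-spec : ∀ c r → - (+ 2) * - sgn c * r + - (+ 2) * isZero c * r ≡ weight c * r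
weight-spec zero    = solve-∀
weight-spec (suc c) = λ r → spec (sgn c) r
  where
  spec : ∀ s r → - (+ 2) * - (- s) * r + - (+ 2) * 0ℤ * r ≡ - (+ 2) * s * r
  spec = solve-∀

weight-jump : ∀ c → weight (suc c) - weight c ≡ + 2 * isZero c + - (+ 4) * sgn c
weight-jump zero    = refl
weight-jump (suc c) = jump (sgn c)
  where
  jump : ∀ s → - (+ 2) * - s - - (+ 2) * s ≡ + 2 * 0ℤ + - (+ 4) * - s
  jump = solve-∀

phiCoeff-weight : ∀ ℓ S k → phiCoeff ℓ S k ≡ ΣposRoots ℓ (λ a b → weight (sCount S a b) * rootCoeff a b k)
phiCoeff-weight ℓ S k = trans (sym (ΣposRoots-+ ℓ _ _))
  (ΣposRoots-cong ℓ (λ a b _ _ _ → weight-spec (sCount S a b) (rootCoeff a b k)))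

xi-ΣposRoots : ∀ ℓ S i → xi ℓ S i ≡ ΣposRoots ℓ (λ a b → weight (sCount S a b) * (edge i a - edge i (suc b)))
xi-ΣposRoots ℓ S i = trans (Σ-cong 1 ℓ (λ k _ _ → cong (cartanA i k *_) (phiCoeff-weight ℓ S k)))
                           (cartanA-ΣposRoots ℓ i (λ a b → weight (sCount S a b)))

-- Sums over the roots starting or ending at a node

module _ (ℓ : ℕ) (S : List ℕ) where

  rootsFrom : (ℕ → ℤ) → ℕ → ℤ
  rootsFrom g x = Σ[ x ⋯ ℓ ] (λ b → g (sCount S x b))

  rootsTo : (ℕ → ℤ) → ℕ → ℤ
  rootsTo g y = Σ[ 1 ⋯ y ] (λ a → g (sCount S a y))

  rootsFrom-paintedStart : ∀ g y → inS S y ≡ true → y ≤ ℓ → rootsFrom g y ≡ g 1 + rootsFrom (g ∘ suc) (suc y)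
  rootsFrom-paintedStart g y y∈S y≤ℓ = begin
    rootsFrom g y                                                               ≡⟨ Σ-split y ℓ y _ (ℕₚ.n≤1+n y) y≤ℓ ⟩
    Σ[ y ⋯ y ] (λ b → g (sCount S y b)) + Σ[ suc y ⋯ ℓ ] (λ b → g (sCount S y b)) ≡⟨ cong₂ _+_ first rest ⟩
    g 1 + rootsFrom (g ∘ suc) (suc y)                                           ∎
    where
    open ≡-Reasoning
    first : Σ[ y ⋯ y ] (λ b → g (sCount S y b)) ≡ g 1
    first = trans (Σ-single y _) (cong g (sCount-painted S y y∈S))
    rest : Σ[ suc y ⋯ ℓ ] (λ b → g (sCount S y b)) ≡ rootsFrom (g ∘ suc) (suc y)
    rest  = Σ-cong (suc y) ℓ (λ b y<b _ → cong g (sCount-paintedˡ S y b y∈S (ℕₚ.<⇒≤ y<b)))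

  rootsTo-paintedEnd : ∀ g y → 1 ≤ y → inS S y ≡ true → rootsTo g y ≡ rootsTo (g ∘ suc) (pred y) + g 1
  rootsTo-paintedEnd g (suc y) _ 1+y∈S = begin
    rootsTo g (suc y)                                                                      ≡⟨ Σ-split 1 (suc y) y _ (s≤s z≤n) (ℕₚ.n≤1+n y) ⟩
    Σ[ 1 ⋯ y ] (λ a → g (sCount S a (suc y))) + Σ[ suc y ⋯ suc y ] (λ a → g (sCount S a (suc y))) ≡⟨ cong₂ _+_ rest last ⟩
    rootsTo (g ∘ suc) y + g 1                                                              ∎
    where
    open ≡-Reasoning
    rest : Σ[ 1 ⋯ y ] (λ a → g (sCount S a (suc y))) ≡ rootsTo (g ∘ suc) y
    rest = Σ-cong 1 y (λ a _ a≤y → cong g (sCount-paintedʳ S a y 1+y∈S (ℕₚ.m≤n⇒m≤1+n a≤y)))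
    last : Σ[ suc y ⋯ suc y ] (λ a → g (sCount S a (suc y))) ≡ g 1
    last = trans (Σ-single (suc y) _) (cong g (sCount-painted S (suc y) 1+y∈S))

  rootsFrom-unpainted : ∀ g x y → x ≤ y → y ≤ suc ℓ → (∀ k → x ≤ k → k < y → inS S k ≡ false) →
    rootsFrom g x ≡ + (y ∸ x) * g 0 + rootsFrom g y
  rootsFrom-unpainted g .zero zero    z≤n _ _ = sym (trans (cong (_+ rootsFrom g 0) (ℤₚ.*-zeroˡ (g 0))) (ℤₚ.+-identityˡ _))
  rootsFrom-unpainted g x     (suc y) x≤1+y 1+y≤1+ℓ k∉S = begin
    rootsFrom g x                                                                   ≡⟨ Σ-split x ℓ y _ x≤1+y (ℕₚ.≤-pred 1+y≤1+ℓ) ⟩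
    Σ[ x ⋯ y ] (λ b → g (sCount S x b)) + Σ[ suc y ⋯ ℓ ] (λ b → g (sCount S x b))     ≡⟨ cong₂ _+_ gap rest ⟩
    + (suc y ∸ x) * g 0 + rootsFrom g (suc y)                                       ∎
    where
    open ≡-Reasoning
    empty : ∀ b → b ≤ y → sCount S x b ≡ 0
    empty b b≤y = sCount-unpainted S x b (λ k x≤k k≤b → k∉S k x≤k (s≤s (ℕₚ.≤-trans k≤b b≤y)))
    gap : Σ[ x ⋯ y ] (λ b → g (sCount S x b)) ≡ + (suc y ∸ x) * g 0
    gap = trans (Σ-cong x y (λ b _ b≤y → cong g (empty b b≤y))) (Σ-const x y (g 0))
    rest : Σ[ suc y ⋯ ℓ ] (λ b → g (sCount S x b)) ≡ rootsFrom g (suc y)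
    rest = Σ-cong (suc y) ℓ (λ b y<b _ → cong g (trans (sCount-split S x b y x≤1+y (ℕₚ.<⇒≤ y<b))
                                                        (cong (ℕ._+ sCount S (suc y) b) (empty y ℕₚ.≤-refl))))

  rootsTo-unpainted : ∀ g x y → x < y → (∀ k → x < k → k < y → inS S k ≡ false) →
    rootsTo g (pred y) ≡ rootsTo g x + + (y ∸ suc x) * g 0
  rootsTo-unpainted g x (suc y) (s≤s x≤y) k∉S = begin
    rootsTo g y                                                                   ≡⟨ Σ-split 1 y x _ (s≤s z≤n) x≤y ⟩
    Σ[ 1 ⋯ x ] (λ a → g (sCount S a y)) + Σ[ suc x ⋯ y ] (λ a → g (sCount S a y)) ≡⟨ cong₂ _+_ rest gap ⟩
    rootsTo g x + + (y ∸ x) * g 0                                                 ∎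
    where
    open ≡-Reasoning
    empty : ∀ a → x < a → sCount S a y ≡ 0
    empty a x<a = sCount-unpainted S a y (λ k a≤k k≤y → k∉S k (ℕₚ.<-≤-trans x<a a≤k) (s≤s k≤y))
    rest : Σ[ 1 ⋯ x ] (λ a → g (sCount S a y)) ≡ rootsTo g x
    rest = Σ-cong 1 x (λ a _ a≤x → cong g (trans (sCount-split S a y x (ℕₚ.m≤n⇒m≤1+n a≤x) x≤y)
                                                  (trans (cong (sCount S a x ℕ.+_) (empty (suc x) ℕₚ.≤-refl)) (ℕₚ.+-identityʳ _))))
    gap : Σ[ suc x ⋯ y ] (λ a → g (sCount S a y)) ≡ + (y ∸ x) * g 0
    gap = trans (Σ-cong (suc x) y (λ a x<a _ → cong g (empty a x<a))) (Σ-const (suc x) y (g 0))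

  rootsFrom-isZero-painted : ∀ y → inS S y ≡ true → y ≤ ℓ → rootsFrom isZero y ≡ 0ℤ
  rootsFrom-isZero-painted y y∈S y≤ℓ =
    trans (rootsFrom-paintedStart isZero y y∈S y≤ℓ) (trans (ℤₚ.+-identityˡ _) (Σ-zero (suc y) ℓ (λ _ _ _ → refl)))

  rootsTo-isZero-painted : ∀ y → 1 ≤ y → inS S y ≡ true → rootsTo isZero y ≡ 0ℤ
  rootsTo-isZero-painted y 1≤y y∈S =
    trans (rootsTo-paintedEnd isZero y 1≤y y∈S) (trans (ℤₚ.+-identityʳ _) (Σ-zero 1 (pred y) (λ _ _ _ → refl)))

  rootsFrom-painted : ∀ i → inS S i ≡ true → i ≤ ℓ →
    rootsFrom weight i - rootsFrom weight (suc i) ≡ - (+ 2) + (+ 2 * rootsFrom isZero (suc i) + - (+ 4) * rootsFrom sgn (suc i))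
  rootsFrom-painted i i∈S i≤ℓ = begin
    rootsFrom weight i - rootsFrom weight (suc i)
      ≡⟨ cong (_- rootsFrom weight (suc i)) (rootsFrom-paintedStart weight i i∈S i≤ℓ) ⟩
    (- (+ 2) + rootsFrom (weight ∘ suc) (suc i)) - rootsFrom weight (suc i)
      ≡⟨ ℤₚ.+-assoc (- (+ 2)) (rootsFrom (weight ∘ suc) (suc i)) (- rootsFrom weight (suc i)) ⟩
    - (+ 2) + (rootsFrom (weight ∘ suc) (suc i) - rootsFrom weight (suc i))
      ≡⟨ cong (_+_ (- (+ 2))) (sym (Σ-sub (suc i) ℓ _ _)) ⟩
    - (+ 2) + Σ[ suc i ⋯ ℓ ] (λ b → weight (suc (sCount S (suc i) b)) - weight (sCount S (suc i) b))
      ≡⟨ cong (_+_ (- (+ 2))) (trans (Σ-cong (suc i) ℓ (λ b _ _ → weight-jump (sCount S (suc i) b)))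
                                     (Σ-lincomb (suc i) ℓ (+ 2) (- (+ 4)) (isZero ∘ sCount S (suc i)) (sgn ∘ sCount S (suc i)))) ⟩
    - (+ 2) + (+ 2 * rootsFrom isZero (suc i) + - (+ 4) * rootsFrom sgn (suc i))
      ∎
    where open ≡-Reasoning

  rootsTo-painted : ∀ i → inS S (suc i) ≡ true →
    rootsTo weight (suc i) - rootsTo weight i ≡ - (+ 2) + (+ 2 * rootsTo isZero i + - (+ 4) * rootsTo sgn i)
  rootsTo-painted i 1+i∈S = begin
    rootsTo weight (suc i) - rootsTo weight i
      ≡⟨ cong (_- rootsTo weight i) (rootsTo-paintedEnd weight (suc i) (s≤s z≤n) 1+i∈S) ⟩
    (rootsTo (weight ∘ suc) i + - (+ 2)) - rootsTo weight i
      ≡⟨ reorder (rootsTo (weight ∘ suc) i) (- (+ 2)) (rootsTo weight i) ⟩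
    - (+ 2) + (rootsTo (weight ∘ suc) i - rootsTo weight i)
      ≡⟨ cong (_+_ (- (+ 2))) (sym (Σ-sub 1 i _ _)) ⟩
    - (+ 2) + Σ[ 1 ⋯ i ] (λ a → weight (suc (sCount S a i)) - weight (sCount S a i))
      ≡⟨ cong (_+_ (- (+ 2))) (trans (Σ-cong 1 i (λ a _ _ → weight-jump (sCount S a i)))
                                     (Σ-lincomb 1 i (+ 2) (- (+ 4)) (λ a → isZero (sCount S a i)) (λ a → sgn (sCount S a i)))) ⟩
    - (+ 2) + (+ 2 * rootsTo isZero i + - (+ 4) * rootsTo sgn i)
      ∎
    where
    open ≡-Reasoning
    reorder : ∀ x y z → (x + y) - z ≡ y + (x - z)
    reorder = solve-∀

  xi-painted : ∀ i → 1 ≤ i → inS S i ≡ true → i ≤ ℓ →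
    xi ℓ S i ≡ (- (+ 2) + (+ 2 * rootsFrom isZero (suc i) + - (+ 4) * rootsFrom sgn (suc i)))
             + (- (+ 2) + (+ 2 * rootsTo isZero (pred i) + - (+ 4) * rootsTo sgn (pred i)))
  xi-painted (suc i) _ 1+i∈S 1+i≤ℓ = begin
    xi ℓ S (suc i)
      ≡⟨ xi-ΣposRoots ℓ S (suc i) ⟩
    ΣposRoots ℓ (λ a b → weight (sCount S a b) * (edge (suc i) a - edge (suc i) (suc b)))
      ≡⟨ ΣposRoots-edge ℓ (λ a b → weight (sCount S a b)) i 1+i≤ℓ ⟩
    from (suc i) - from (suc (suc i)) - to i + to (suc i)
      ≡⟨ regroup (from (suc i)) (from (suc (suc i))) (to i) (to (suc i)) ⟩
    (from (suc i) - from (suc (suc i))) + (to (suc i) - to i)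
      ≡⟨ cong₂ _+_ (rootsFrom-painted (suc i) 1+i∈S 1+i≤ℓ) (rootsTo-painted i 1+i∈S) ⟩
    (- (+ 2) + (+ 2 * rootsFrom isZero (suc (suc i)) + - (+ 4) * rootsFrom sgn (suc (suc i))))
      + (- (+ 2) + (+ 2 * rootsTo isZero i + - (+ 4) * rootsTo sgn i))
      ∎
    where
    open ≡-Reasoning
    from to : ℕ → ℤ
    from = rootsFrom weight
    to   = rootsTo weight
    regroup : ∀ a b c d → a - b - c + d ≡ (a - b) + (d - c)
    regroup = solve-∀

-- Recurrences along the painted nodes

module _ (ℓ : ℕ) (is : List ℕ) where

  private
    I : ℕ → ℕ
    I = extIdx ℓ is

  Splus-last : ∀ m → Splus ℓ m is m ≡ + I (suc m) - + suc ℓ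
  Splus-last m = begin
    Splus ℓ m is m                    ≡⟨ cong₂ (λ x y → x + + I (suc m) + sgn (suc y) * + suc ℓ)
                                                 (Σ-empty (suc m) m _ (ℕₚ.n<1+n m)) (ℕₚ.n∸n≡0 m) ⟩
    0ℤ + + I (suc m) + -1ℤ * + suc ℓ  ≡⟨ simplify (+ I (suc m)) (+ suc ℓ) ⟩
    + I (suc m) - + suc ℓ             ∎
    where
    open ≡-Reasoning
    simplify : ∀ x y → 0ℤ + x + -1ℤ * y ≡ x - y
    simplify = solve-∀

  Splus-consecutive : ∀ m J → suc J ≤ m → Splus ℓ m is J + Splus ℓ m is (suc J) ≡ + I (suc (suc J)) - + I (suc J)
  Splus-consecutive m J J<m = begin
    Splus ℓ m is J + Splus ℓ m is (suc J)
      ≡⟨ cong₂ (λ x y → x + + I (suc J) + sgn (suc y) * + suc ℓ + Splus ℓ m is (suc J)) sum-split (∸-suc m J J<m) ⟩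
    (+ 2 * -1ℤ * + I (suc J) + -1ℤ * rest) + + I (suc J) + - t * + suc ℓ + (rest + + I (suc (suc J)) + t * + suc ℓ)
      ≡⟨ cancel (+ I (suc J)) (+ I (suc (suc J))) rest t (+ suc ℓ) ⟩
    + I (suc (suc J)) - + I (suc J)
      ∎
    where
    open ≡-Reasoning
    term : ℕ → ℕ → ℤ
    term j k = + 2 * sgn (k ∸ j) * + I k
    rest t : ℤ
    rest = Σ[ suc (suc J) ⋯ m ] (term (suc J))
    t    = sgn (suc (m ∸ suc J))
    ∸-suc : ∀ n d → d < n → n ∸ d ≡ suc (n ∸ suc d)
    ∸-suc (suc n) zero    _         = refl
    ∸-suc (suc n) (suc d) (s≤s d<n) = ∸-suc n d d<n
    flip : ∀ s x → + 2 * - s * x ≡ -1ℤ * (+ 2 * s * x)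
    flip = solve-∀
    shifted : ∀ k → suc J < k → term J k ≡ -1ℤ * term (suc J) k
    shifted k 1+J<k = trans (cong (λ u → + 2 * sgn u * + I k) (∸-suc k J (ℕₚ.<-trans (ℕₚ.n<1+n J) 1+J<k)))
                            (flip (sgn (k ∸ suc J)) (+ I k))
    sum-split : Σ[ suc J ⋯ m ] (term J) ≡ + 2 * -1ℤ * + I (suc J) + -1ℤ * rest
    sum-split = begin
      Σ[ suc J ⋯ m ] (term J)                                    ≡⟨ Σ-split (suc J) m (suc J) (term J) (ℕₚ.n≤1+n (suc J)) J<m ⟩
      Σ[ suc J ⋯ suc J ] (term J) + Σ[ suc (suc J) ⋯ m ] (term J) ≡⟨ cong₂ _+_ (Σ-single (suc J) (term J))
                                                                              (Σ-cong (suc (suc J)) m (λ k 1+J<k _ → shifted k 1+J<k)) ⟩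
      term J (suc J) + Σ[ suc (suc J) ⋯ m ] (λ k → -1ℤ * term (suc J) k)
                                                                 ≡⟨ cong₂ _+_ (cong (λ u → + 2 * sgn u * + I (suc J)) (ℕₚ.m+n∸n≡m 1 J))
                                                                              (Σ-*ˡ (suc (suc J)) m -1ℤ (term (suc J))) ⟩
      + 2 * -1ℤ * + I (suc J) + -1ℤ * rest                       ∎
    cancel : ∀ a b r t l → (+ 2 * -1ℤ * a + -1ℤ * r) + a + - t * l + (r + b + t * l) ≡ b - a
    cancel = solve-∀

  Sminus-first : Sminus ℓ is 1 ≡ 0ℤ
  Sminus-first = cong (_+ + 0) (Σ-empty 1 0 (λ k → + 2 * sgn (1 ∸ k) * + I k) (s≤s z≤n))

  Sminus-consecutive : ∀ J → Sminus ℓ is (suc (suc J)) + Sminus ℓ is (suc J) ≡ + I J - + I (suc J)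
  Sminus-consecutive J = begin
    Sminus ℓ is (suc (suc J)) + Sminus ℓ is (suc J)
      ≡⟨ cong (λ x → x + + I (suc J) + Sminus ℓ is (suc J)) sum-split ⟩
    (-1ℤ * rest + + 2 * -1ℤ * + I (suc J)) + + I (suc J) + (rest + + I J)
      ≡⟨ cancel rest (+ I J) (+ I (suc J)) ⟩
    + I J - + I (suc J)
      ∎
    where
    open ≡-Reasoning
    term : ℕ → ℕ → ℤ
    term j k = + 2 * sgn (j ∸ k) * + I k
    rest : ℤ
    rest = Σ[ 1 ⋯ J ] (term (suc J))
    flip : ∀ s x → + 2 * - s * x ≡ -1ℤ * (+ 2 * s * x)
    flip = solve-∀
    shifted : ∀ k → k ≤ J → term (suc (suc J)) k ≡ -1ℤ * term (suc J) k
    shifted k k≤J = trans (cong (λ u → + 2 * sgn u * + I k) (ℕₚ.+-∸-assoc 1 (ℕₚ.m≤n⇒m≤1+n k≤J)))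
                          (flip (sgn (suc J ∸ k)) (+ I k))
    sum-split : Σ[ 1 ⋯ suc J ] (term (suc (suc J))) ≡ -1ℤ * rest + + 2 * -1ℤ * + I (suc J)
    sum-split = begin
      Σ[ 1 ⋯ suc J ] (term (suc (suc J)))                                   ≡⟨ Σ-split 1 (suc J) J _ (s≤s z≤n) (ℕₚ.n≤1+n J) ⟩
      Σ[ 1 ⋯ J ] (term (suc (suc J))) + Σ[ suc J ⋯ suc J ] (term (suc (suc J))) ≡⟨ cong₂ _+_ (Σ-cong 1 J (λ k _ k≤J → shifted k k≤J))
                                                                                                 (Σ-single (suc J) _) ⟩
      Σ[ 1 ⋯ J ] (λ k → -1ℤ * term (suc J) k) + term (suc (suc J)) (suc J)   ≡⟨ cong₂ _+_ (Σ-*ˡ 1 J -1ℤ (term (suc J)))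
                                                                                  (cong (λ u → + 2 * sgn u * + I (suc J)) (ℕₚ.m+n∸n≡m 1 (suc J))) ⟩
      -1ℤ * rest + + 2 * -1ℤ * + I (suc J)                                  ∎
    cancel : ∀ r a b → (-1ℤ * r + + 2 * -1ℤ * b) + b + (r + a) ≡ a - b
    cancel = solve-∀

stepwise-increasing⇒monotone : ∀ (f : ℕ → ℕ) m → (∀ n → n ≤ m → f n < f (suc n)) →
                               ∀ a b → a ≤ b → b ≤ suc m → f a ≤ f b
stepwise-increasing⇒monotone f m f-inc a zero    z≤n     _ = ℕₚ.≤-refl
stepwise-increasing⇒monotone f m f-inc a (suc b) a≤1+b 1+b≤1+m with ℕₚ.m≤n⇒m<n∨m≡n a≤1+b
... | inj₂ refl       = ℕₚ.≤-refl
... | inj₁ (s≤s a≤b) =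
  ℕₚ.≤-trans (stepwise-increasing⇒monotone f m f-inc a b a≤b (ℕₚ.m≤n⇒m≤1+n b≤m)) (ℕₚ.<⇒≤ (f-inc b b≤m))
  where
  b≤m : b ≤ m
  b≤m = ℕₚ.≤-pred 1+b≤1+m

module PaintedIndices (ℓ m : ℕ) (S : List ℕ)
  (I-increasing : ∀ n → n ≤ m → extIdx ℓ S n < extIdx ℓ S (suc n))
  (I-top : extIdx ℓ S (suc m) ≡ suc ℓ)
  (I-painted : ∀ j → j < m → inS S (extIdx ℓ S (suc j)) ≡ true)
  (between-unpainted : ∀ n k → n ≤ m → extIdx ℓ S n < k → k < extIdx ℓ S (suc n) → inS S k ≡ false)
  where

  I : ℕ → ℕ
  I = extIdx ℓ S

  I-mono : ∀ a b → a ≤ b → b ≤ suc m → I a ≤ I b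
  I-mono = stepwise-increasing⇒monotone I m I-increasing

  I-positive : ∀ j → j < m → 1 ≤ I (suc j)
  I-positive j j<m = ℕₚ.<-≤-trans (I-increasing 0 z≤n) (I-mono 1 (suc j) (s≤s z≤n) (ℕₚ.m≤n⇒m≤1+n j<m))

  I-bounded : ∀ n → n ≤ m → I (suc n) ≤ suc ℓ
  I-bounded n n≤m = subst (I (suc n) ≤_) I-top (I-mono (suc n) (suc m) (s≤s n≤m) ℕₚ.≤-refl)

  I-≤ℓ : ∀ j → j < m → I (suc j) ≤ ℓ
  I-≤ℓ j j<m = ℕₚ.≤-pred (ℕₚ.<-≤-trans (I-increasing (suc j) j<m) (I-bounded (suc j) j<m))

  gap : ℕ → ℤ
  gap n = + I (suc n) - + I n - 1ℤ

  gap-length : ∀ n → n ≤ m → + (I (suc n) ∸ suc (I n)) ≡ gap n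
  gap-length n n≤m = begin
    + (I (suc n) ∸ suc (I n))   ≡⟨ ℤₚ.⊖-≥ (I-increasing n n≤m) ⟨
    I (suc n) ⊖ suc (I n)       ≡⟨ ℤₚ.m-n≡m⊖n (I (suc n)) (suc (I n)) ⟨
    + I (suc n) - + suc (I n)   ≡⟨ reassoc (+ I (suc n)) (+ I n) ⟩
    gap n                       ∎
    where
    open ≡-Reasoning
    reassoc : ∀ x y → x - (1ℤ + y) ≡ x - y - 1ℤ
    reassoc = solve-∀

  rootsFrom-afterIndex : ∀ g n → n ≤ m → rootsFrom ℓ S g (suc (I n)) ≡ gap n * g 0 + rootsFrom ℓ S g (I (suc n))
  rootsFrom-afterIndex g n n≤m =
    trans (rootsFrom-unpainted ℓ S g (suc (I n)) (I (suc n)) (I-increasing n n≤m) (I-bounded n n≤m)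
                               (λ k → between-unpainted n k n≤m))
          (cong (λ x → x * g 0 + rootsFrom ℓ S g (I (suc n))) (gap-length n n≤m))

  rootsFrom-beyondTop : ∀ g → rootsFrom ℓ S g (I (suc m)) ≡ 0ℤ
  rootsFrom-beyondTop g rewrite I-top = Σ-empty (suc ℓ) ℓ _ (ℕₚ.n<1+n ℓ)

  rootsFrom-isZero-afterIndex : ∀ n → n ≤ m → rootsFrom ℓ S isZero (suc (I n)) ≡ gap n
  rootsFrom-isZero-afterIndex n n≤m =
    trans (rootsFrom-afterIndex isZero n n≤m) (trans (cong (_+_ (gap n * 1ℤ)) next) (simplify (gap n)))
    where
    next : rootsFrom ℓ S isZero (I (suc n)) ≡ 0ℤ
    next with ℕₚ.m≤n⇒m<n∨m≡n n≤m
    ... | inj₁ n<m = rootsFrom-isZero-painted ℓ S (I (suc n)) (I-painted n n<m) (I-≤ℓ n n<m)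
    ... | inj₂ refl = rootsFrom-beyondTop isZero
    simplify : ∀ x → x * 1ℤ + 0ℤ ≡ x
    simplify = solve-∀

  rootsFrom-sgn-last : rootsFrom ℓ S sgn (suc (I m)) ≡ gap m
  rootsFrom-sgn-last = trans (rootsFrom-afterIndex sgn m ℕₚ.≤-refl)
    (trans (cong (_+_ (gap m * 1ℤ)) (rootsFrom-beyondTop sgn)) (simplify (gap m)))
    where
    simplify : ∀ x → x * 1ℤ + 0ℤ ≡ x
    simplify = solve-∀

  rootsFrom-sgn-step : ∀ n → suc n ≤ m →
    rootsFrom ℓ S sgn (suc (I n)) ≡ gap n - 1ℤ - rootsFrom ℓ S sgn (suc (I (suc n)))
  rootsFrom-sgn-step n n<m = begin
    rootsFrom ℓ S sgn (suc (I n))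
      ≡⟨ rootsFrom-afterIndex sgn n (ℕₚ.<⇒≤ n<m) ⟩
    gap n * 1ℤ + rootsFrom ℓ S sgn (I (suc n))
      ≡⟨ cong (_+_ (gap n * 1ℤ)) (rootsFrom-paintedStart ℓ S sgn (I (suc n)) (I-painted n n<m) (I-≤ℓ n n<m)) ⟩
    gap n * 1ℤ + (-1ℤ + rootsFrom ℓ S (λ c → - sgn c) (suc (I (suc n))))
      ≡⟨ cong (λ x → gap n * 1ℤ + (-1ℤ + x)) (Σ-neg (suc (I (suc n))) ℓ _) ⟩
    gap n * 1ℤ + (-1ℤ + - rootsFrom ℓ S sgn (suc (I (suc n))))
      ≡⟨ simplify (gap n) _ ⟩
    gap n - 1ℤ - rootsFrom ℓ S sgn (suc (I (suc n)))
      ∎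
    where
    open ≡-Reasoning
    simplify : ∀ x r → x * 1ℤ + (-1ℤ + - r) ≡ x - 1ℤ - r
    simplify = solve-∀

  rootsTo-beforeIndex : ∀ g n → n < m → rootsTo ℓ S g (pred (I (suc n))) ≡ rootsTo ℓ S g (I n) + gap n * g 0
  rootsTo-beforeIndex g n n<m =
    trans (rootsTo-unpainted ℓ S g (I n) (I (suc n)) (I-increasing n (ℕₚ.<⇒≤ n<m))
                             (λ k → between-unpainted n k (ℕₚ.<⇒≤ n<m)))
          (cong (λ x → rootsTo ℓ S g (I n) + x * g 0) (gap-length n (ℕₚ.<⇒≤ n<m)))

  rootsTo-isZero-atIndex : ∀ n → n ≤ m → rootsTo ℓ S isZero (I n) ≡ 0ℤ
  rootsTo-isZero-atIndex zero    _     = refl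
  rootsTo-isZero-atIndex (suc j) 1+j≤m = rootsTo-isZero-painted ℓ S (I (suc j)) (I-positive j 1+j≤m) (I-painted j 1+j≤m)

  rootsTo-isZero-beforeIndex : ∀ n → n < m → rootsTo ℓ S isZero (pred (I (suc n))) ≡ gap n
  rootsTo-isZero-beforeIndex n n<m = trans (rootsTo-beforeIndex isZero n n<m)
    (trans (cong (_+ gap n * 1ℤ) (rootsTo-isZero-atIndex n (ℕₚ.<⇒≤ n<m))) (simplify (gap n)))
    where
    simplify : ∀ x → 0ℤ + x * 1ℤ ≡ x
    simplify = solve-∀

  rootsTo-sgn-first : 0 < m → rootsTo ℓ S sgn (pred (I 1)) ≡ gap 0
  rootsTo-sgn-first 0<m = trans (rootsTo-beforeIndex sgn 0 0<m) (simplify (gap 0))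
    where
    simplify : ∀ x → 0ℤ + x * 1ℤ ≡ x
    simplify = solve-∀

  rootsTo-sgn-step : ∀ j → suc j < m →
    rootsTo ℓ S sgn (pred (I (suc (suc j)))) ≡ gap (suc j) - 1ℤ - rootsTo ℓ S sgn (pred (I (suc j)))
  rootsTo-sgn-step j 1+j<m = begin
    rootsTo ℓ S sgn (pred (I (suc (suc j))))
      ≡⟨ rootsTo-beforeIndex sgn (suc j) 1+j<m ⟩
    rootsTo ℓ S sgn (I (suc j)) + gap (suc j) * 1ℤ
      ≡⟨ cong (_+ gap (suc j) * 1ℤ) (rootsTo-paintedEnd ℓ S sgn (I (suc j)) (I-positive j j<m) (I-painted j j<m)) ⟩
    rootsTo ℓ S (λ c → - sgn c) (pred (I (suc j))) + -1ℤ + gap (suc j) * 1ℤ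
      ≡⟨ cong (λ x → x + -1ℤ + gap (suc j) * 1ℤ) (Σ-neg 1 (pred (I (suc j))) _) ⟩
    - rootsTo ℓ S sgn (pred (I (suc j))) + -1ℤ + gap (suc j) * 1ℤ
      ≡⟨ simplify (gap (suc j)) _ ⟩
    gap (suc j) - 1ℤ - rootsTo ℓ S sgn (pred (I (suc j)))
      ∎
    where
    open ≡-Reasoning
    j<m : j < m
    j<m = ℕₚ.<-trans (ℕₚ.n<1+n j) 1+j<m
    simplify : ∀ x r → - r + -1ℤ + x * 1ℤ ≡ x - 1ℤ - r
    simplify = solve-∀

  Splus-rootsFrom : ∀ J → J ≤ m → Splus ℓ m S J ≡ gap J - rootsFrom ℓ S sgn (suc (I J))
  Splus-rootsFrom J J≤m = downFrom (m ∸ J) J (ℕₚ.m∸n+n≡m J≤m)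
    where
    downFrom : ∀ d J → d ℕ.+ J ≡ m → Splus ℓ m S J ≡ gap J - rootsFrom ℓ S sgn (suc (I J))
    downFrom zero    J refl = begin
      Splus ℓ m S m                              ≡⟨ Splus-last ℓ S m ⟩
      + I (suc m) - + suc ℓ                      ≡⟨ cong (λ x → + x - + suc ℓ) I-top ⟩
      + suc ℓ - + suc ℓ                          ≡⟨ ℤₚ.+-inverseʳ (+ suc ℓ) ⟩
      0ℤ                                         ≡⟨ ℤₚ.+-inverseʳ (gap m) ⟨
      gap m - gap m                              ≡⟨ cong (_-_ (gap m)) rootsFrom-sgn-last ⟨
      gap m - rootsFrom ℓ S sgn (suc (I m))      ∎
      where open ≡-Reasoning
    downFrom (suc d) J d+1+J≡m = begin
      Splus ℓ m S J
        ≡⟨ isolate (Splus-consecutive ℓ S m J J<m) ⟩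
      (+ I (suc (suc J)) - + I (suc J)) - Splus ℓ m S (suc J)
        ≡⟨ cong (_-_ (+ I (suc (suc J)) - + I (suc J))) (downFrom d (suc J) (trans (ℕₚ.+-suc d J) d+1+J≡m)) ⟩
      (+ I (suc (suc J)) - + I (suc J)) - (gap (suc J) - rootsFrom ℓ S sgn (suc (I (suc J))))
        ≡⟨ both-one-more (+ I (suc J)) (+ I (suc (suc J))) (gap J) (rootsFrom ℓ S sgn (suc (I (suc J)))) ⟩
      gap J - (gap J - 1ℤ - rootsFrom ℓ S sgn (suc (I (suc J))))
        ≡⟨ cong (_-_ (gap J)) (rootsFrom-sgn-step J J<m) ⟨
      gap J - rootsFrom ℓ S sgn (suc (I J))
        ∎
      where
      open ≡-Reasoning
      J<m : suc J ≤ m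
      J<m = subst (suc J ≤_) d+1+J≡m (s≤s (ℕₚ.m≤n+m J d))
      both-one-more : ∀ a b g r → (b - a) - (b - a - 1ℤ - r) ≡ g - (g - 1ℤ - r)
      both-one-more = solve-∀

  Sminus-rootsTo : ∀ j → j < m → Sminus ℓ S (suc j) ≡ rootsTo ℓ S sgn (pred (I (suc j))) - gap j
  Sminus-rootsTo zero    0<m = begin
    Sminus ℓ S 1                               ≡⟨ Sminus-first ℓ S ⟩
    0ℤ                                         ≡⟨ ℤₚ.+-inverseʳ (gap 0) ⟨
    gap 0 - gap 0                              ≡⟨ cong (_- gap 0) (rootsTo-sgn-first 0<m) ⟨
    rootsTo ℓ S sgn (pred (I 1)) - gap 0       ∎
    where open ≡-Reasoning
  Sminus-rootsTo (suc j) 1+j<m = begin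
    Sminus ℓ S (suc (suc j))
      ≡⟨ isolate (Sminus-consecutive ℓ S j) ⟩
    (+ I j - + I (suc j)) - Sminus ℓ S (suc j)
      ≡⟨ cong (_-_ (+ I j - + I (suc j))) (Sminus-rootsTo j (ℕₚ.<-trans (ℕₚ.n<1+n j) 1+j<m)) ⟩
    (+ I j - + I (suc j)) - (rootsTo ℓ S sgn (pred (I (suc j))) - gap j)
      ≡⟨ both-one-less (+ I j) (+ I (suc j)) (rootsTo ℓ S sgn (pred (I (suc j)))) (gap (suc j)) ⟩
    (gap (suc j) - 1ℤ - rootsTo ℓ S sgn (pred (I (suc j)))) - gap (suc j)
      ≡⟨ cong (_- gap (suc j)) (rootsTo-sgn-step j 1+j<m) ⟨
    rootsTo ℓ S sgn (pred (I (suc (suc j)))) - gap (suc j)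
      ∎
    where
    open ≡-Reasoning
    both-one-less : ∀ a₀ a₁ l g → (a₀ - a₁) - (l - (a₁ - a₀ - 1ℤ)) ≡ (g - 1ℤ - l) - g
    both-one-less = solve-∀

  xi-atIndex : ∀ j → j < m →
    xi ℓ S (I (suc j)) ≡ + 2 * (+ I j - + I (suc (suc j)) + + 2 * (Splus ℓ m S (suc j) - Sminus ℓ S (suc j)))
  xi-atIndex j j<m = begin
    xi ℓ S (I (suc j))
      ≡⟨ xi-painted ℓ S (I (suc j)) (I-positive j j<m) (I-painted j j<m) (I-≤ℓ j j<m) ⟩
    (- (+ 2) + (+ 2 * rootsFrom ℓ S isZero (suc (I (suc j))) + - (+ 4) * R))
      + (- (+ 2) + (+ 2 * rootsTo ℓ S isZero (pred (I (suc j))) + - (+ 4) * L))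
      ≡⟨ cong₂ (λ x y → (- (+ 2) + (+ 2 * x + - (+ 4) * R)) + (- (+ 2) + (+ 2 * y + - (+ 4) * L)))
           (rootsFrom-isZero-afterIndex (suc j) j<m) (rootsTo-isZero-beforeIndex j j<m) ⟩
    (- (+ 2) + (+ 2 * gap (suc j) + - (+ 4) * R)) + (- (+ 2) + (+ 2 * gap j + - (+ 4) * L))
      ≡⟨ regroup (+ I j) (+ I (suc j)) (+ I (suc (suc j))) R L ⟩
    + 2 * (+ I j - + I (suc (suc j)) + + 2 * ((gap (suc j) - R) - (L - gap j)))
      ≡⟨ cong₂ (λ x y → + 2 * (+ I j - + I (suc (suc j)) + + 2 * (x - y)))
           (Splus-rootsFrom (suc j) j<m) (Sminus-rootsTo j j<m) ⟨
    + 2 * (+ I j - + I (suc (suc j)) + + 2 * (Splus ℓ m S (suc j) - Sminus ℓ S (suc j)))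
      ∎
    where
    open ≡-Reasoning
    R L : ℤ
    R = rootsFrom ℓ S sgn (suc (I (suc j)))
    L = rootsTo ℓ S sgn (pred (I (suc j)))
    regroup : ∀ a₀ a₁ a₂ r l →
      (- (+ 2) + (+ 2 * (a₂ - a₁ - 1ℤ) + - (+ 4) * r)) + (- (+ 2) + (+ 2 * (a₁ - a₀ - 1ℤ) + - (+ 4) * l))
        ≡ + 2 * (a₀ - a₂ + + 2 * (((a₂ - a₁ - 1ℤ) - r) - (l - (a₁ - a₀ - 1ℤ))))
    regroup = solve-∀

-- The painted set given as an increasing vector

lookupOr-toList : ∀ {m} (is : Vec ℕ m) (j : Fin m) d → lookupOr (toList is) (toℕ j) d ≡ lookup is j
lookupOr-toList (x ∷ is) zero    d = refl
lookupOr-toList (x ∷ is) (suc j) d = lookupOr-toList is j d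

lookupOr-toList-length : ∀ {m} (is : Vec ℕ m) d → lookupOr (toList is) m d ≡ d
lookupOr-toList-length []       d = refl
lookupOr-toList-length (x ∷ is) d = lookupOr-toList-length is d

inS-lookup : ∀ {m} (is : Vec ℕ m) j → inS (toList is) (lookup is j) ≡ true
inS-lookup (x ∷ is) zero    = cong (_∨ inS (toList is) x) (≡ᵇ-refl x)
inS-lookup (x ∷ is) (suc j) = trans (cong ((x ≡ᵇ lookup is j) ∨_) (inS-lookup is j)) (Boolₚ.∨-zeroʳ _)

inS⇒lookup : ∀ {m} (is : Vec ℕ m) k → inS (toList is) k ≡ true → ∃ λ j → lookup is j ≡ k
inS⇒lookup (x ∷ is) k k∈is with x ≡ᵇ k in x≡ᵇk
... | true  = zero , ℕₚ.≡ᵇ⇒≡ x k (Equivalence.from Boolₚ.T-≡ x≡ᵇk)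
... | false = let j , j↦k = inS⇒lookup is k k∈is in suc j , j↦k

module _ (ℓ : ℕ) {m} (is : Vec ℕ m)
  (increasing : ∀ (a b : Fin m) → toℕ a < toℕ b → lookup is a < lookup is b)
  (bounded : ∀ (a : Fin m) → (1 ≤ lookup is a) × (lookup is a ≤ ℓ))
  where

  private
    I : ℕ → ℕ
    I = extIdx ℓ (toList is)

  extIdx-lookup : ∀ n (n<m : n < m) → I (suc n) ≡ lookup is (fromℕ< n<m)
  extIdx-lookup n n<m =
    trans (cong (λ t → lookupOr (toList is) t (suc ℓ)) (sym (Finₚ.toℕ-fromℕ< n<m))) (lookupOr-toList is _ _)

  extIdx-top : I (suc m) ≡ suc ℓ
  extIdx-top = lookupOr-toList-length is (suc ℓ)

  extIdx-increasing : 1 ≤ m → ∀ n → n ≤ m → I n < I (suc n)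
  extIdx-increasing 1≤m zero    _     = subst (1 ≤_) (sym (extIdx-lookup 0 1≤m)) (proj₁ (bounded _))
  extIdx-increasing _   (suc n) 1+n≤m with ℕₚ.m≤n⇒m<n∨m≡n 1+n≤m
  ... | inj₁ 1+n<m = subst₂ _<_ (sym (extIdx-lookup n 1+n≤m)) (sym (extIdx-lookup (suc n) 1+n<m))
                       (increasing _ _ (subst₂ _<_ (sym (Finₚ.toℕ-fromℕ< 1+n≤m)) (sym (Finₚ.toℕ-fromℕ< 1+n<m))
                                                   (ℕₚ.n<1+n n)))
  ... | inj₂ refl  = subst₂ _<_ (sym (extIdx-lookup n 1+n≤m)) (sym extIdx-top) (s≤s (proj₂ (bounded _)))

  extIdx-painted : ∀ n → n < m → inS (toList is) (I (suc n)) ≡ true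
  extIdx-painted n n<m = subst (λ x → inS (toList is) x ≡ true) (sym (extIdx-lookup n n<m)) (inS-lookup is _)

  extIdx-between-unpainted : 1 ≤ m → ∀ n k → n ≤ m → I n < k → k < I (suc n) → inS (toList is) k ≡ false
  extIdx-between-unpainted 1≤m n k n≤m Iₙ<k k<Iₙ₊₁ = Boolₚ.¬-not k∉is
    where
    mono : ∀ a b → a ≤ b → b ≤ suc m → I a ≤ I b
    mono = stepwise-increasing⇒monotone I m (extIdx-increasing 1≤m)
    I[1+j]≡k : ∀ j → lookup is j ≡ k → I (suc (toℕ j)) ≡ k
    I[1+j]≡k j j↦k = trans (lookupOr-toList is j (suc ℓ)) j↦k
    k∉is : inS (toList is) k ≢ true
    k∉is k∈is with j , j↦k ← inS⇒lookup is k k∈is | suc (toℕ j) ℕ.≤? n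
    ... | yes 1+j≤n = ℕₚ.<⇒≱ Iₙ<k (subst (_≤ I n) (I[1+j]≡k j j↦k) (mono _ n 1+j≤n (ℕₚ.m≤n⇒m≤1+n n≤m)))
    ... | no  1+j≰n = ℕₚ.<⇒≱ k<Iₙ₊₁ (subst (I (suc n) ≤_) (I[1+j]≡k j j↦k)
                                     (mono (suc n) _ (ℕₚ.≰⇒> 1+j≰n) (s≤s (ℕₚ.<⇒≤ (Finₚ.toℕ<n j)))))

mainTheorem2 : (ℓ : ℕ) → 1 ≤ ℓ → (m : ℕ) → 1 ≤ m → (is : Vec ℕ m)
    → (∀ (a b : Fin m) → toℕ a < toℕ b → lookup is a < lookup is b)
    → (∀ (a : Fin m) → (1 ≤ lookup is a) × (lookup is a ≤ ℓ))
    → ∀ (j : Fin m) →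
      xi ℓ (toList is) (lookup is j)
        ≡ + 2 * (+ extIdx ℓ (toList is) (toℕ j)
                 - + extIdx ℓ (toList is) (suc (suc (toℕ j)))
                 + + 2 * (Splus ℓ m (toList is) (suc (toℕ j))
                          - Sminus ℓ (toList is) (suc (toℕ j))))
mainTheorem2 ℓ _ m 1≤m is increasing bounded j =
  trans (cong (xi ℓ (toList is)) (sym (lookupOr-toList is j (suc ℓ))))
        (PaintedIndices.xi-atIndex ℓ m (toList is)
          (extIdx-increasing ℓ is increasing bounded 1≤m)
          (extIdx-top ℓ is increasing bounded)
          (extIdx-painted ℓ is increasing bounded)
          (extIdx-between-unpainted ℓ is increasing bounded 1≤m)
          (toℕ j) (Finₚ.toℕ<n j))
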